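{- Let $n\geq 1$, $N=n(n+1)(n+2)(n+3)(n+4)$ and $b=F_nF_{n+1}F_{n+2}F_{n+3}F_{n+4}$. Then \[ z(b)=\begin{cases} N/2, & \text{if } n\equiv 1,7\pmod{12};\\ N/3, & \text{if } n\equiv 9,11\pmod{12};\\ N/4, & \text{if } n\equiv 10\pmod{12} \text{ or } n\equiv 0,20,48,68\pmod{72};\\ N/6, & \text{if } n\equiv 3,5\pmod{12};\\ N/8, & \text{if } n\equiv 4\pmod{12} \text{ or } n\equiv 12,32,36,56\pmod{72};\\ N/12, & \text{if } n\equiv 2,6\pmod{12} \text{ or } n\equiv 24,44\pmod{72};\\ N/24, & \text{if } n\equiv 8,60\pmod{72}. \end{cases} \]
   Context: $F_n$ is the $n$th Fibonacci number ($F_1=F_2=1$, $F_n=F_{n-1}+F_{n-2}$). For a positive integer $m$, $z(m)$ is the smallest positive integer $k$ with $m\mid F_k$. -}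

module Defs where

open import Data.Nat using (ℕ; zero; suc; _+_; _*_; _<_; _≤_)
open import Data.Nat.Divisibility using (_∣_)
open import Data.Product using (_×_)
open import Relation.Nullary using (¬_)

F : ℕ → ℕ
F zero = 0
F (suc zero) = 1
F (suc (suc n)) = F (suc n) + F n

IsZ : ℕ → ℕ → Set
IsZ m k = (0 < k) × (m ∣ F k) × (∀ j → 0 < j → j < k → ¬ (m ∣ F j))

bigN : ℕ → ℕ
bigN n = n * (n + 1) * (n + 2) * (n + 3) * (n + 4)

bigB : ℕ → ℕ
bigB n = F n * F (n + 1) * F (n + 2) * F (n + 3) * F (n + 4)

-- For i < l ≤ 4, gcd (F (n + i)) (F (n + l)) = F (gcd (n + i) (n + l)) divides F (l ∸ i), which
-- divides 12, and gcd (n + i) (n + l) ∣ l ∸ i ∣ 12. Writing n + i = 2 ^ αᵢ * 3 ^ βᵢ * uᵢ, this gives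
-- N = 2 ^ Σ αᵢ * 3 ^ Σ βᵢ * ∏ uᵢ and b = 2 ^ A * 3 ^ C * ∏ wᵢ with the uᵢ, and the wᵢ, pairwise
-- coprime and prime to 6. As F (n + i) ∣ F j forces n + i ∣ j, and the 2- and 3-adic valuations of
-- Fibonacci numbers are known explicitly, z(b) = 2 ^ X * 3 ^ Y * ∏ uᵢ with X = max (αᵢ, ν₂ z(2 ^ A))
-- and Y = max (βᵢ, C ∸ 1), so N / z(b) = 2 ^ (Σ αᵢ ∸ X) * 3 ^ (Σ βᵢ ∸ Y). At most one n + i is
-- divisible by 8 (resp. 9); the excess e of its valuation enters every exponent affinely with
-- slope 0 or 1 and cancels in the quotient, which therefore depends only on n mod 72 and is
-- computed symbolically in e for each residue.

module Submission where

open import Defs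
open import Data.Nat
open import Data.Nat.Properties
open import Data.Nat.Divisibility
open import Data.Nat.DivMod
open import Data.Nat.Coprimality using (Coprime; coprime-divisor; prime⇒coprime)
import Data.Nat.Coprimality as Coprime
open import Data.Nat.GCD
open import Data.Nat.Induction using (<-rec)
open import Data.Nat.Primality using (Prime; ¬prime[1]; prime[2]; prime?; prime⇒irreducible; euclidsLemma)
open import Data.Nat.Tactic.RingSolver using (solve-∀)
open import Data.Product using (∃-syntax; ∃₂; _×_; _,_; proj₁; proj₂)
open import Data.Product.Properties using (≡-dec)
open import Data.Sum using (_⊎_; inj₁; inj₂)
open import Function using (_∘_)
open import Relation.Nullary using (¬_; Dec; yes; no; contradiction)
open import Relation.Nullary.Decidable using (True; toWitness; from-yes; ¬?; _×-dec_; _⊎-dec_; _→-dec_)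
open import Relation.Binary.PropositionalEquality

-- Divisibility of Fibonacci numbers

F-+ : ∀ m n → F (m + suc n) ≡ F (suc m) * F (suc n) + F m * F n
F-+ m zero = trans (cong F (+-comm m 1)) (ring (F (suc m)) (F m))
  where
  ring : ∀ a b → a ≡ a * 1 + b * 0
  ring = solve-∀
F-+ m (suc zero) = trans (cong F (+-comm m 2)) (ring (F (suc m)) (F m))
  where
  ring : ∀ a b → a + b ≡ a * 1 + b * 1
  ring = solve-∀
F-+ m (suc (suc n)) = begin
  F (m + suc (suc (suc n)))
    ≡⟨ cong F (+-suc m (suc (suc n))) ⟩
  F (suc (m + suc (suc n)))
    ≡⟨ cong (λ k → F (suc k)) (+-suc m (suc n)) ⟩
  F (suc (suc (m + suc n)))
    ≡⟨ cong (λ k → F k + F (m + suc n)) (+-suc m (suc n)) ⟨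
  F (m + suc (suc n)) + F (m + suc n)
    ≡⟨ cong₂ _+_ (F-+ m (suc n)) (F-+ m n) ⟩
  a * x + b * y + (a * y + b * z)
    ≡⟨ ring a b x y z ⟩
  a * (x + y) + b * (y + z) ∎
  where
  open ≡-Reasoning
  a = F (suc m); b = F m; x = F (suc (suc n)); y = F (suc n); z = F n
  ring : ∀ a b x y z → a * x + b * y + (a * y + b * z) ≡ a * (x + y) + b * (y + z)
  ring = solve-∀

F-coprime-suc : ∀ n → Coprime (F n) (F (suc n))
F-coprime-suc n (d∣Fn , d∣Fn+1) = ∣1⇒≡1 (common n d∣Fn d∣Fn+1)
  where
  common : ∀ {d} n → d ∣ F n → d ∣ F (suc n) → d ∣ 1
  common zero    _ d∣F1 = d∣F1
  common (suc n) d∣Fn+1 d∣Fn+2 = common n (∣m+n∣m⇒∣n d∣Fn+2 d∣Fn+1) d∣Fn+1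

∣F[m+n]∣F[n]⇒∣F[m] : ∀ {d} m n → d ∣ F (m + n) → d ∣ F n → d ∣ F m
∣F[m+n]∣F[n]⇒∣F[m] {d} m zero d∣F[m+0] _ = subst (λ k → d ∣ F k) (+-identityʳ m) d∣F[m+0]
∣F[m+n]∣F[n]⇒∣F[m] {d} m (suc n) d∣F[m+n] d∣F[n] =
  coprime-divisor d⊥F[n-1] (subst (d ∣_) (*-comm (F m) (F n)) d∣FmFn)
  where
  d∣FmFn : d ∣ F m * F n
  d∣FmFn = ∣m+n∣m⇒∣n (subst (d ∣_) (F-+ m n) d∣F[m+n]) (∣n⇒∣m*n (F (suc m)) d∣F[n])
  d⊥F[n-1] : Coprime d (F n)
  d⊥F[n-1] (e∣d , e∣Fn) = F-coprime-suc n (e∣Fn , ∣-trans e∣d d∣F[n])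

F∣F[k*m] : ∀ m k → F m ∣ F (k * m)
F∣F[k*m] m       zero    = F m ∣0
F∣F[k*m] zero    (suc k) = subst (λ j → F 0 ∣ F j) (sym (*-zeroʳ (suc k))) ∣-refl
F∣F[k*m] (suc m) (suc k) = subst (F (suc m) ∣_) (sym F[m+km]) (∣m∣n⇒∣m+n
  (∣n⇒∣m*n (F (suc (k * suc m))) ∣-refl)
  (∣m⇒∣m*n (F m) (F∣F[k*m] (suc m) k)))
  where
  F[m+km] : F (suc m + k * suc m) ≡ F (suc (k * suc m)) * F (suc m) + F (k * suc m) * F m
  F[m+km] = trans (cong F (+-comm (suc m) (k * suc m))) (F-+ (k * suc m) m)

∣⇒F∣F : ∀ {m n} → m ∣ n → F m ∣ F n
∣⇒F∣F {m} (divides k refl) = F∣F[k*m] m k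

∣F[m]⇒∣F[k*m] : ∀ {d} m k → d ∣ F m → d ∣ F (k * m)
∣F[m]⇒∣F[k*m] m k d∣Fm = ∣-trans d∣Fm (F∣F[k*m] m k)

∣F[m]∣F[n]⇒∣F[gcd] : ∀ {d} m n → d ∣ F m → d ∣ F n → d ∣ F (gcd m n)
∣F[m]∣F[n]⇒∣F[gcd] {d} m n d∣Fm d∣Fn with Bézout.lemma m n
... | Bézout.result g isGCD (Bézout.+- x y g+yn≡xm) =
  subst (λ k → d ∣ F k) (GCD.unique isGCD (gcd-GCD m n)) (∣F[m+n]∣F[n]⇒∣F[m] g (y * n)
    (subst (λ k → d ∣ F k) (sym g+yn≡xm) (∣F[m]⇒∣F[k*m] m x d∣Fm)) (∣F[m]⇒∣F[k*m] n y d∣Fn))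
... | Bézout.result g isGCD (Bézout.-+ x y g+xm≡yn) =
  subst (λ k → d ∣ F k) (GCD.unique isGCD (gcd-GCD m n)) (∣F[m+n]∣F[n]⇒∣F[m] g (x * m)
    (subst (λ k → d ∣ F k) (sym g+xm≡yn) (∣F[m]⇒∣F[k*m] n y d∣Fn)) (∣F[m]⇒∣F[k*m] m x d∣Fm))

F>0 : ∀ {n} → 0 < n → 0 < F n
F>0 {1}           _ = z<s
F>0 {suc (suc n)} _ = ≤-trans (F>0 {suc n} z<s) (m≤m+n (F (suc n)) (F n))

F-mono-≤ : ∀ {m n} → m ≤ n → F m ≤ F n
F-mono-≤ {m} m≤n with m≤n⇒∃[o]m+o≡n m≤n
... | o , refl = F[m]≤F[m+o] o
  where
  F-suc : ∀ k → F k ≤ F (suc k)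
  F-suc zero    = z≤n
  F-suc (suc k) = m≤m+n (F (suc k)) (F k)
  F[m]≤F[m+o] : ∀ o → F m ≤ F (m + o)
  F[m]≤F[m+o] zero    = ≤-reflexive (cong F (sym (+-identityʳ m)))
  F[m]≤F[m+o] (suc o) = ≤-trans (F[m]≤F[m+o] o) (subst (F (m + o) ≤_) (cong F (sym (+-suc m o))) (F-suc (m + o)))

F-mono-< : ∀ {m n} → 0 < m → m < n → 3 ≤ n → F m < F n
F-mono-< {m} {suc (suc (suc k))} _ (s≤s m≤k+2) (s≤s (s≤s (s≤s _))) =
  subst (_≤ F (3 + k)) (+-comm (F m) 1) (+-mono-≤ (F-mono-≤ m≤k+2) (F>0 {suc k} z<s))

F∣F⇒∣ : ∀ {m n} → 3 ≤ m → 0 < n → F m ∣ F n → m ∣ n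
F∣F⇒∣ {m} {n} 3≤m 0<n Fm∣Fn with gcd m n ≟ m
... | yes g≡m = subst (_∣ n) g≡m (gcd[m,n]∣n m n)
... | no  g≢m = contradiction (∣⇒≤ {{>-nonZero (F>0 0<g)}} Fm∣Fg) (<⇒≱ (F-mono-< 0<g g<m 3≤m))
  where
  g = gcd m n
  Fm∣Fg : F m ∣ F g
  Fm∣Fg = ∣F[m]∣F[n]⇒∣F[gcd] m n ∣-refl Fm∣Fn
  g<m : g < m
  g<m = ≤∧≢⇒< (∣⇒≤ {{>-nonZero (≤-trans (s≤s z≤n) 3≤m)}} (gcd[m,n]∣m m n)) g≢m
  0<g : 0 < g
  0<g = n≢0⇒n>0 (λ g≡0 → <⇒≢ 0<n (sym (0∣⇒≡0 (subst (_∣ n) g≡0 (gcd[m,n]∣n m n)))))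

F[m+m] : ∀ k → F (suc k + suc k) ≡ F (suc k) * (F (suc k) + 2 * F k)
F[m+m] k = trans (F-+ (suc k) k) (ring (F (suc k)) (F k))
  where
  ring : ∀ a b → (a + b) * a + a * b ≡ a * (a + 2 * b)
  ring = solve-∀

F[m+m+m] : ∀ k → let a = F (suc k); b = F k in
  F (suc k + suc k + suc k) ≡ a * (2 * (a * a) + 3 * (a * b) + 3 * (b * b))
F[m+m+m] k = begin
  F (suc k + suc k + suc k)             ≡⟨ F-+ (suc k + suc k) k ⟩
  F (suc (suc k + suc k)) * a + F (suc k + suc k) * b
    ≡⟨ cong (λ x → F x * a + F (suc k + suc k) * b) (+-suc (suc k) (suc k)) ⟨
  F (suc k + suc (suc k)) * a + F (suc k + suc k) * b
    ≡⟨ cong₂ (λ x y → x * a + y * b) (F-+ (suc k) (suc k)) (F[m+m] k) ⟩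
  ((a + b) * (a + b) + a * a) * a + a * (a + 2 * b) * b
    ≡⟨ ring a b ⟩
  a * (2 * (a * a) + 3 * (a * b) + 3 * (b * b)) ∎
  where
  open ≡-Reasoning
  a = F (suc k); b = F k
  ring : ∀ a b → ((a + b) * (a + b) + a * a) * a + a * (a + 2 * b) * b
               ≡ a * (2 * (a * a) + 3 * (a * b) + 3 * (b * b))
  ring = solve-∀

-- Coprimality and exact prime powers

coprime-*ˡ : ∀ {a b c} → Coprime a c → Coprime b c → Coprime (a * b) c
coprime-*ˡ {a} a⊥c b⊥c (d∣ab , d∣c) = b⊥c (coprime-divisor d⊥a d∣ab , d∣c)
  where
  d⊥a : Coprime _ a
  d⊥a (e∣d , e∣a) = a⊥c (e∣a , ∣-trans e∣d d∣c)

coprime-*ʳ : ∀ {a b c} → Coprime c a → Coprime c b → Coprime c (a * b)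
coprime-*ʳ c⊥a c⊥b = Coprime.sym (coprime-*ˡ (Coprime.sym c⊥a) (Coprime.sym c⊥b))

coprime-^ˡ : ∀ {a c} → Coprime a c → ∀ k → Coprime (a ^ k) c
coprime-^ˡ a⊥c zero    = Coprime.1-coprimeTo _
coprime-^ˡ a⊥c (suc k) = coprime-*ˡ a⊥c (coprime-^ˡ a⊥c k)

coprime⇒*∣ : ∀ {a b j} → Coprime a b → a ∣ j → b ∣ j → a * b ∣ j
coprime⇒*∣ {a} {b} a⊥b (divides q refl) b∣qa
  with coprime-divisor (Coprime.sym a⊥b) (subst (b ∣_) (*-comm q a) b∣qa)
... | divides r refl = divides r (ring r b a)
  where
  ring : ∀ r b a → r * b * a ≡ r * (a * b)
  ring = solve-∀

prime[3] : Prime 3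
prime[3] = from-yes (prime? 3)

prime∤⇒coprime : ∀ {p n} → Prime p → p ∤ n → Coprime p n
prime∤⇒coprime {p} p-prime p∤n {d} (d∣p , d∣n) with prime⇒irreducible p-prime d∣p
... | inj₁ d≡1    = d≡1
... | inj₂ refl   = contradiction d∣n p∤n

∤-* : ∀ {p m n} → Prime p → p ∤ m → p ∤ n → p ∤ m * n
∤-* {m = m} {n} p-prime p∤m p∤n p∣mn with euclidsLemma m n p-prime p∣mn
... | inj₁ p∣m = p∤m p∣m
... | inj₂ p∣n = p∤n p∣n

coprime[2^a,3^c] : ∀ a c → Coprime (2 ^ a) (3 ^ c)
coprime[2^a,3^c] a c = coprime-^ˡ (Coprime.sym (coprime-^ˡ 3⊥2 c)) a
  where
  3⊥2 : Coprime 3 2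
  3⊥2 = prime⇒coprime prime[3] (s≤s (s≤s (s≤s z≤n)))

infix 4 _^_∥_

record _^_∥_ (p a x : ℕ) : Set where
  constructor exact
  field
    cofactor   : ℕ
    x≡         : x ≡ p ^ a * cofactor
    p∤cofactor : p ∤ cofactor

^-monoʳ-∣ : ∀ p {e a} → e ≤ a → p ^ e ∣ p ^ a
^-monoʳ-∣ p {e} e≤a with m≤n⇒∃[o]m+o≡n e≤a
... | o , refl = divides (p ^ o) (trans (^-distribˡ-+-* p e o) (*-comm (p ^ e) (p ^ o)))

∥⇒∣ : ∀ {p a e x} → p ^ a ∥ x → e ≤ a → p ^ e ∣ x
∥⇒∣ {p} (exact o refl _) e≤a = ∣m⇒∣m*n o (^-monoʳ-∣ p e≤a)

∥∧∣⇒≤ : ∀ {p a e x} .{{_ : NonZero p}} → p ^ a ∥ x → p ^ e ∣ x → e ≤ a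
∥∧∣⇒≤ {p} {a} {e} (exact o refl p∤o) pᵉ∣x with e ≤? a
... | yes e≤a = e≤a
... | no  e≰a = contradiction (*-cancelˡ-∣ (p ^ a) {{m^n≢0 p a}} pᵃp∣pᵃo) p∤o
  where
  pᵃp∣pᵃo : p ^ a * p ∣ p ^ a * o
  pᵃp∣pᵃo = ∣-trans (∣-reflexive (*-comm (p ^ a) p)) (∣-trans (^-monoʳ-∣ p (≰⇒> e≰a)) pᵉ∣x)

∣∧∤⇒∥ : ∀ {p a x} .{{_ : NonZero p}} → p ^ a ∣ x → p ^ suc a ∤ x → p ^ a ∥ x
∣∧∤⇒∥ {p} {a} (divides o refl) pᵃ⁺¹∤x = exact o (*-comm o (p ^ a)) p∤o
  where
  ring : ∀ q p pᵃ → q * p * pᵃ ≡ q * (p * pᵃ)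
  ring = solve-∀
  p∤o : p ∤ o
  p∤o (divides q refl) = pᵃ⁺¹∤x (divides q (ring q p (p ^ a)))

∃-∥ : ∀ p {x} → 1 < p → 0 < x → ∃[ a ] p ^ a ∥ x
∃-∥ p {x} 1<p = <-rec (λ x → 0 < x → ∃[ a ] p ^ a ∥ x) split x
  where
  instance
    p≢0 : NonZero p
    p≢0 = >-nonZero (<-trans z<s 1<p)
  split : ∀ x → (∀ {y} → y < x → 0 < y → ∃[ a ] p ^ a ∥ y) → 0 < x → ∃[ a ] p ^ a ∥ x
  split x rec 0<x with p ∣? x
  ... | no  p∤x = 0 , exact x (sym (+-identityʳ x)) p∤x
  ... | yes (divides y refl) with rec y<yp 0<y
    where
    0<y : 0 < y
    0<y = n≢0⇒n>0 λ { refl → <⇒≢ 0<x refl }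
    y<yp : y < y * p
    y<yp = m<m*n y p {{>-nonZero 0<y}} 1<p
  ... | a , exact o refl p∤o = suc a , exact o (ring (p ^ a) o p) p∤o
    where
    ring : ∀ pᵃ o p → pᵃ * o * p ≡ p * pᵃ * o
    ring = solve-∀

coprime⇒∤ : ∀ {p n} → 1 < p → Coprime p n → p ∤ n
coprime⇒∤ 1<p p⊥n p∣n = <⇒≢ 1<p (sym (p⊥n (∣-refl , p∣n)))

2∤3^ : ∀ c → 2 ∤ 3 ^ c
2∤3^ c = coprime⇒∤ (s≤s (s≤s z≤n)) (coprime[2^a,3^c] 1 c)

3∤2^ : ∀ a → 3 ∤ 2 ^ a
3∤2^ a = coprime⇒∤ (s≤s (s≤s z≤n)) (Coprime.sym (coprime[2^a,3^c] a 1))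

record Val₂₃ (x a c : ℕ) : Set where
  constructor val₂₃
  field
    cofactor   : ℕ
    x≡         : x ≡ 2 ^ a * 3 ^ c * cofactor
    2∤cofactor : 2 ∤ cofactor
    3∤cofactor : 3 ∤ cofactor

Val₂₃⇒2∥ : ∀ {x a c} → Val₂₃ x a c → 2 ^ a ∥ x
Val₂₃⇒2∥ {a = a} {c} (val₂₃ w x≡ 2∤w _) =
  exact (3 ^ c * w) (trans x≡ (*-assoc (2 ^ a) (3 ^ c) w)) (∤-* prime[2] (2∤3^ c) 2∤w)

Val₂₃⇒3∥ : ∀ {x a c} → Val₂₃ x a c → 3 ^ c ∥ x
Val₂₃⇒3∥ {a = a} {c} (val₂₃ w x≡ _ 3∤w) =
  exact (2 ^ a * w) (trans x≡ (ring (2 ^ a) (3 ^ c) w)) (∤-* prime[3] (3∤2^ a) 3∤w)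
  where
  ring : ∀ x y w → x * y * w ≡ y * (x * w)
  ring = solve-∀

∥∧∥⇒Val₂₃ : ∀ {x a c} → 2 ^ a ∥ x → 3 ^ c ∥ x → Val₂₃ x a c
∥∧∥⇒Val₂₃ {a = a} {c} (exact o refl 2∤o) 3ᶜ∥x
  with coprime-divisor (Coprime.sym (coprime[2^a,3^c] a c)) (∥⇒∣ {e = c} 3ᶜ∥x ≤-refl)
... | divides w refl = val₂₃ w (ring (2 ^ a) w (3 ^ c)) (λ 2∣w → 2∤o (∣m⇒∣m*n (3 ^ c) 2∣w)) 3∤w
  where
  ring : ∀ x w y → x * (w * y) ≡ x * y * w
  ring = solve-∀
  3∤w : 3 ∤ w
  3∤w (divides q refl) = <-irrefl refl (∥∧∣⇒≤ {e = suc c} 3ᶜ∥x (divides (2 ^ a * q) (ring′ (2 ^ a) q (3 ^ c))))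
    where
    ring′ : ∀ x q y → x * (q * 3 * y) ≡ x * q * (3 * y)
    ring′ = solve-∀

∃-Val₂₃ : ∀ {x} → 0 < x → ∃₂ (Val₂₃ x)
∃-Val₂₃ 0<x with ∃-∥ 2 (s≤s (s≤s z≤n)) 0<x | ∃-∥ 3 (s≤s (s≤s z≤n)) 0<x
... | a , 2ᵃ∥x | c , 3ᶜ∥x = a , c , ∥∧∥⇒Val₂₃ 2ᵃ∥x 3ᶜ∥x

-- 2- and 3-adic valuations of Fibonacci numbers

entry-point-∣ : ∀ {d M j} → 0 < M → d ∣ F M → (∀ {g} → g < M → ¬ (g ∣ M × d ∣ F g)) → d ∣ F j → M ∣ j
entry-point-∣ {d} {M} {j} 0<M d∣FM minimal d∣Fj with gcd j M ≟ M
... | yes g≡M = subst (_∣ j) g≡M (gcd[m,n]∣m j M)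
... | no  g≢M = contradiction (gcd[m,n]∣n j M , ∣F[m]∣F[n]⇒∣F[gcd] j M d∣Fj d∣FM) (minimal g<M)
  where
  g<M : gcd j M < M
  g<M = ≤∧≢⇒< (∣⇒≤ {{>-nonZero 0<M}} (gcd[m,n]∣n j M)) g≢M

no-earlier-multiple? : ∀ d M → Dec (∀ {g} → g < M → ¬ (g ∣ M × d ∣ F g))
no-earlier-multiple? d M = allUpTo? (λ g → ¬? (g ∣? M ×-dec d ∣? F g)) M

2∣F⇒3∣ : ∀ {j} → 2 ∣ F j → 3 ∣ j
2∣F⇒3∣ = entry-point-∣ z<s ∣-refl (from-yes (no-earlier-multiple? 2 3))

4∣F⇒6∣ : ∀ {j} → 4 ∣ F j → 6 ∣ j
4∣F⇒6∣ = entry-point-∣ z<s (divides 2 refl) (from-yes (no-earlier-multiple? 4 6))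

16∣F⇒12∣ : ∀ {j} → 16 ∣ F j → 12 ∣ j
16∣F⇒12∣ = entry-point-∣ z<s (divides 9 refl) (from-yes (no-earlier-multiple? 16 12))

3∣F⇒4∣ : ∀ {j} → 3 ∣ F j → 4 ∣ j
3∣F⇒4∣ = entry-point-∣ z<s ∣-refl (from-yes (no-earlier-multiple? 3 4))

9∣F⇒12∣ : ∀ {j} → 9 ∣ F j → 12 ∣ j
9∣F⇒12∣ = entry-point-∣ z<s (divides 16 refl) (from-yes (no-earlier-multiple? 9 12))

2^0∥F : ∀ {m} → 3 ∤ m → 2 ^ 0 ∥ F m
2^0∥F {m} 3∤m = exact (F m) (sym (*-identityˡ (F m))) λ 2∣Fm → 3∤m (2∣F⇒3∣ 2∣Fm)

3^0∥F : ∀ {m} → 4 ∤ m → 3 ^ 0 ∥ F m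
3^0∥F {m} 4∤m = exact (F m) (sym (*-identityˡ (F m))) λ 3∣Fm → 4∤m (3∣F⇒4∣ 3∣Fm)

2^1∥F[3*k] : ∀ {k} → 2 ∤ k → 2 ^ 1 ∥ F (3 * k)
2^1∥F[3*k] {k} 2∤k = ∣∧∤⇒∥ {2} {1} (∣⇒F∣F (m∣m*n {3} k)) λ 4∣F → 2∤k (*-cancelˡ-∣ 3 (4∣F⇒6∣ 4∣F))

2^3∥F[6*k] : ∀ {k} → 2 ∤ k → 2 ^ 3 ∥ F (6 * k)
2^3∥F[6*k] {k} 2∤k = ∣∧∤⇒∥ {2} {3} (∣⇒F∣F (m∣m*n {6} k)) λ 16∣F → 2∤k (*-cancelˡ-∣ 6 (16∣F⇒12∣ 16∣F))

3^1∥F[4*k] : ∀ {k} → 3 ∤ k → 3 ^ 1 ∥ F (4 * k)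
3^1∥F[4*k] {k} 3∤k = ∣∧∤⇒∥ {3} {1} (∣⇒F∣F (m∣m*n {4} k)) λ 9∣F → 3∤k (*-cancelˡ-∣ 4 (9∣F⇒12∣ 9∣F))

¬∥0 : ∀ {p a} .{{_ : NonZero p}} → ¬ p ^ a ∥ 0
¬∥0 {p} {a} pᵃ∥0 = <-irrefl refl (∥∧∣⇒≤ {e = suc a} pᵃ∥0 ((p ^ suc a) ∣0))

∣F[suc]⇒∤F : ∀ {d} k → 1 < d → d ∣ F (suc k) → d ∤ F k
∣F[suc]⇒∤F k 1<d d∣Fk+1 d∣Fk = <⇒≢ 1<d (sym (F-coprime-suc k (d∣Fk , d∣Fk+1)))

2^∥F[m+m] : ∀ {m a} → 2 ≤ a → 2 ^ a ∥ F m → 2 ^ suc a ∥ F (m + m)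
2^∥F[m+m] {zero}  _ 2ᵃ∥F0 = contradiction 2ᵃ∥F0 ¬∥0
2^∥F[m+m] {suc k} {suc (suc a)} (s≤s (s≤s _)) (exact o Fm≡ 2∤o) = exact (o * odd) F[2m]≡ (∤-* prime[2] 2∤o 2∤odd)
  where
  b = F k
  odd = 2 ^ suc a * o + b
  2∤b : 2 ∤ b
  2∤b = ∣F[suc]⇒∤F k (s≤s (s≤s z≤n)) (subst (2 ∣_) (sym Fm≡) (∣m⇒∣m*n o (∣n⇒∣m*n 2 (m∣m*n (2 ^ a)))))
  2∤odd : 2 ∤ odd
  2∤odd 2∣odd = 2∤b (∣m+n∣m⇒∣n 2∣odd (∣m⇒∣m*n o (m∣m*n (2 ^ a))))
  ring : ∀ x o b → 2 * (2 * x) * o * (2 * (2 * x) * o + 2 * b) ≡ 2 * (2 * (2 * x)) * (o * (2 * x * o + b))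
  ring = solve-∀
  F[2m]≡ : F (suc k + suc k) ≡ 2 ^ suc (suc (suc a)) * (o * odd)
  F[2m]≡ = begin
    F (suc k + suc k)                   ≡⟨ F[m+m] k ⟩
    F (suc k) * (F (suc k) + 2 * b)     ≡⟨ cong (λ x → x * (x + 2 * b)) Fm≡ ⟩
    2 ^ suc (suc a) * o * (2 ^ suc (suc a) * o + 2 * b) ≡⟨ ring (2 ^ a) o b ⟩
    2 ^ suc (suc (suc a)) * (o * odd)   ∎
    where open ≡-Reasoning

3^∥F[m+m+m] : ∀ {m a} → 1 ≤ a → 3 ^ a ∥ F m → 3 ^ suc a ∥ F (m + m + m)
3^∥F[m+m+m] {zero}  _ 3ᵃ∥F0 = contradiction 3ᵃ∥F0 ¬∥0
3^∥F[m+m+m] {suc k} {suc a} _ (exact o Fm≡ 3∤o) = exact (o * q) F[3m]≡ (∤-* prime[3] 3∤o 3∤q)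
  where
  b = F k
  t = 3 ^ a * o
  q = 6 * (t * t) + 3 * (t * b) + b * b
  3∤b : 3 ∤ b
  3∤b = ∣F[suc]⇒∤F k (s≤s (s≤s z≤n)) (subst (3 ∣_) (sym Fm≡) (∣m⇒∣m*n o (m∣m*n (3 ^ a))))
  3∤q : 3 ∤ q
  3∤q 3∣ = ∤-* prime[3] 3∤b 3∤b (∣m+n∣m⇒∣n 3∣
    (∣m∣n⇒∣m+n (∣m⇒∣m*n (t * t) (divides 2 refl)) (∣m⇒∣m*n (t * b) (∣-refl {3}))))
  ring : ∀ x o b → 3 * x * o * (2 * (3 * x * o * (3 * x * o)) + 3 * (3 * x * o * b) + 3 * (b * b))
                 ≡ 3 * (3 * x) * (o * (6 * (x * o * (x * o)) + 3 * (x * o * b) + b * b))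
  ring = solve-∀
  F[3m]≡ : F (suc k + suc k + suc k) ≡ 3 ^ suc (suc a) * (o * q)
  F[3m]≡ = begin
    F (suc k + suc k + suc k)
      ≡⟨ F[m+m+m] k ⟩
    F (suc k) * (2 * (F (suc k) * F (suc k)) + 3 * (F (suc k) * b) + 3 * (b * b))
      ≡⟨ cong (λ x → x * (2 * (x * x) + 3 * (x * b) + 3 * (b * b))) Fm≡ ⟩
    _ ≡⟨ ring (3 ^ a) o b ⟩
    3 ^ suc (suc a) * (o * q) ∎
    where open ≡-Reasoning

2^∥F[2^e*m] : ∀ {m a} → 2 ≤ a → 2 ^ a ∥ F m → ∀ e → 2 ^ (e + a) ∥ F (2 ^ e * m)
2^∥F[2^e*m] {m} {a} _ 2ᵃ∥Fm zero = subst (λ j → 2 ^ a ∥ F j) (sym (*-identityˡ m)) 2ᵃ∥Fm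
2^∥F[2^e*m] {m} {a} 2≤a 2ᵃ∥Fm (suc e) = subst (λ j → 2 ^ suc (e + a) ∥ F j) (ring (2 ^ e) m)
  (2^∥F[m+m] {2 ^ e * m} (≤-trans 2≤a (m≤n+m _ e)) (2^∥F[2^e*m] 2≤a 2ᵃ∥Fm e))
  where
  ring : ∀ x m → x * m + x * m ≡ 2 * x * m
  ring = solve-∀

3^∥F[3^e*m] : ∀ {m a} → 1 ≤ a → 3 ^ a ∥ F m → ∀ e → 3 ^ (e + a) ∥ F (3 ^ e * m)
3^∥F[3^e*m] {m} {a} _ 3ᵃ∥Fm zero = subst (λ j → 3 ^ a ∥ F j) (sym (*-identityˡ m)) 3ᵃ∥Fm
3^∥F[3^e*m] {m} {a} 1≤a 3ᵃ∥Fm (suc e) = subst (λ j → 3 ^ suc (e + a) ∥ F j) (ring (3 ^ e) m)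
  (3^∥F[m+m+m] {3 ^ e * m} (≤-trans 1≤a (m≤n+m _ e)) (3^∥F[3^e*m] 1≤a 3ᵃ∥Fm e))
  where
  ring : ∀ x m → x * m + x * m + x * m ≡ 3 * x * m
  ring = solve-∀

ν₂F : ℕ → ℕ → ℕ
ν₂F _       zero    = 0
ν₂F zero    (suc _) = 1
ν₂F (suc α) (suc _) = 3 + α

ν₃F : ℕ → ℕ → ℕ
ν₃F (suc (suc _)) β = suc β
ν₃F _             _ = 0

Val₂₃⇒2^ν₂F∥F : ∀ {x α β} → Val₂₃ x α β → 2 ^ ν₂F α β ∥ F x
Val₂₃⇒2^ν₂F∥F {β = zero} v = 2^0∥F λ 3∣x → contradiction (∥∧∣⇒≤ {e = 1} (Val₂₃⇒3∥ v) 3∣x) λ ()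
Val₂₃⇒2^ν₂F∥F {α = zero} {suc β} (val₂₃ u refl 2∤u _) =
  subst (λ j → 2 ^ 1 ∥ F j) (ring (3 ^ β) u) (2^1∥F[3*k] (∤-* prime[2] (2∤3^ β) 2∤u))
  where
  ring : ∀ y u → 3 * (y * u) ≡ 1 * (3 * y) * u
  ring = solve-∀
Val₂₃⇒2^ν₂F∥F {α = suc α} {suc β} (val₂₃ u refl 2∤u _) =
  subst₂ (λ a j → 2 ^ a ∥ F j) (+-comm α 3) (ring (2 ^ α) (3 ^ β) u)
    (2^∥F[2^e*m] (s≤s (s≤s z≤n)) (2^3∥F[6*k] (∤-* prime[2] (2∤3^ β) 2∤u)) α)
  where
  ring : ∀ x y u → x * (6 * (y * u)) ≡ 2 * x * (3 * y) * u
  ring = solve-∀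

Val₂₃⇒3^ν₃F∥F : ∀ {x α β} → Val₂₃ x α β → 3 ^ ν₃F α β ∥ F x
Val₂₃⇒3^ν₃F∥F {α = zero}          v = 3^0∥F λ 4∣x → contradiction (∥∧∣⇒≤ {e = 2} (Val₂₃⇒2∥ v) 4∣x) λ ()
Val₂₃⇒3^ν₃F∥F {α = suc zero}      v = 3^0∥F λ 4∣x → contradiction (∥∧∣⇒≤ {e = 2} (Val₂₃⇒2∥ v) 4∣x) λ where (s≤s ())
Val₂₃⇒3^ν₃F∥F {α = suc (suc α)} {β} (val₂₃ u refl _ 3∤u) =
  subst₂ (λ c j → 3 ^ c ∥ F j) (+-comm β 1) (ring (2 ^ α) (3 ^ β) u)
    (3^∥F[3^e*m] (s≤s z≤n) (3^1∥F[4*k] (∤-* prime[3] (3∤2^ α) 3∤u)) β)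
  where
  ring : ∀ x y u → y * (4 * (x * u)) ≡ 2 * (2 * x) * y * u
  ring = solve-∀

Val₂₃-F : ∀ {x α β} → Val₂₃ x α β → Val₂₃ (F x) (ν₂F α β) (ν₃F α β)
Val₂₃-F v = ∥∧∥⇒Val₂₃ (Val₂₃⇒2^ν₂F∥F v) (Val₂₃⇒3^ν₃F∥F v)

-- z(2 ^ A) is 1, 3, 6 for A ≤ 2 and 3 * 2 ^ (A ∸ 2) for A ≥ 3; ν₂z A is its 2-adic valuation.
ν₂z : ℕ → ℕ
ν₂z zero                = 0
ν₂z (suc zero)          = 0
ν₂z (suc (suc zero))    = 1
ν₂z (suc (suc (suc A))) = suc A

≤ν₂F⇒ν₂z≤ : ∀ {A} α β → A ≤ ν₂F α β → ν₂z A ≤ α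
≤ν₂F⇒ν₂z≤ {zero}                α       β       _ = z≤n
≤ν₂F⇒ν₂z≤ {suc zero}            α       β       _ = z≤n
≤ν₂F⇒ν₂z≤ {suc (suc zero)}      (suc α) (suc β) _ = s≤s z≤n
≤ν₂F⇒ν₂z≤ {suc (suc (suc A))}   (suc α) (suc β) (s≤s (s≤s (s≤s A≤α))) = s≤s A≤α
≤ν₂F⇒ν₂z≤ {suc (suc _)}         α       zero    ()
≤ν₂F⇒ν₂z≤ {suc (suc _)}         zero    (suc β) (s≤s ())

ν₂z≤⇒≤ν₂F : ∀ {A} α β → 1 ≤ β → ν₂z A ≤ α → A ≤ ν₂F α β
ν₂z≤⇒≤ν₂F {zero}              α       β       _ _ = z≤n
ν₂z≤⇒≤ν₂F {suc zero}          zero    (suc β) _ _ = s≤s z≤n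
ν₂z≤⇒≤ν₂F {suc zero}          (suc α) (suc β) _ _ = s≤s z≤n
ν₂z≤⇒≤ν₂F {suc (suc zero)}    (suc α) (suc β) _ _ = s≤s (s≤s z≤n)
ν₂z≤⇒≤ν₂F {suc (suc (suc A))} (suc α) (suc β) _ (s≤s A≤α) = s≤s (s≤s (s≤s A≤α))

≤ν₃F⇒∸1≤ : ∀ {C} α β → C ≤ ν₃F α β → C ∸ 1 ≤ β
≤ν₃F⇒∸1≤ {zero}  α             β _ = z≤n
≤ν₃F⇒∸1≤ {suc C} (suc (suc α)) β (s≤s C≤β) = C≤β

∸1≤⇒≤ν₃F : ∀ {C} α β → 2 ≤ α → C ∸ 1 ≤ β → C ≤ ν₃F α β
∸1≤⇒≤ν₃F {zero}  α β _ _ = z≤n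
∸1≤⇒≤ν₃F {suc C} (suc (suc α)) β (s≤s (s≤s _)) C≤β = s≤s C≤β

2^ν₂z∣⇒2^∣F : ∀ {j} A → 3 ∣ j → 2 ^ ν₂z A ∣ j → 2 ^ A ∣ F j
2^ν₂z∣⇒2^∣F {zero}  A _ _ = (2 ^ A) ∣0
2^ν₂z∣⇒2^∣F {suc j} A 3∣j 2^ν₂zA∣j with ∃-Val₂₃ (z<s {j})
... | α , β , v = ∥⇒∣ {e = A} (Val₂₃⇒2^ν₂F∥F v)
  (ν₂z≤⇒≤ν₂F α β (∥∧∣⇒≤ {e = 1} (Val₂₃⇒3∥ v) 3∣j) (∥∧∣⇒≤ {e = ν₂z A} (Val₂₃⇒2∥ v) 2^ν₂zA∣j))

2^∣F⇒2^ν₂z∣ : ∀ {j} A → 0 < j → 2 ^ A ∣ F j → 2 ^ ν₂z A ∣ j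
2^∣F⇒2^ν₂z∣ A 0<j 2^A∣Fj with ∃-Val₂₃ 0<j
... | α , β , v = ∥⇒∣ {e = ν₂z A} (Val₂₃⇒2∥ v) (≤ν₂F⇒ν₂z≤ α β (∥∧∣⇒≤ {e = A} (Val₂₃⇒2^ν₂F∥F v) 2^A∣Fj))

3^∸1∣⇒3^∣F : ∀ {j} C → 4 ∣ j → 3 ^ (C ∸ 1) ∣ j → 3 ^ C ∣ F j
3^∸1∣⇒3^∣F {zero}  C _ _ = (3 ^ C) ∣0
3^∸1∣⇒3^∣F {suc j} C 4∣j 3^C∸1∣j with ∃-Val₂₃ (z<s {j})
... | α , β , v = ∥⇒∣ {e = C} (Val₂₃⇒3^ν₃F∥F v)
  (∸1≤⇒≤ν₃F α β (∥∧∣⇒≤ {e = 2} (Val₂₃⇒2∥ v) 4∣j) (∥∧∣⇒≤ {e = C ∸ 1} (Val₂₃⇒3∥ v) 3^C∸1∣j))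

3^∣F⇒3^∸1∣ : ∀ {j} C → 0 < j → 3 ^ C ∣ F j → 3 ^ (C ∸ 1) ∣ j
3^∣F⇒3^∸1∣ C 0<j 3^C∣Fj with ∃-Val₂₃ 0<j
... | α , β , v = ∥⇒∣ {e = C ∸ 1} (Val₂₃⇒3∥ v) (≤ν₃F⇒∸1≤ α β (∥∧∣⇒≤ {e = C} (Val₂₃⇒3^ν₃F∥F v) 3^C∣Fj))

-- Five consecutive indices

Σ< : ℕ → (ℕ → ℕ) → ℕ
Σ< zero    f = 0
Σ< (suc k) f = Σ< k f + f k

∏< : ℕ → (ℕ → ℕ) → ℕ
∏< zero    f = 1
∏< (suc k) f = ∏< k f * f k

∏<-* : ∀ k f g → ∏< k (λ i → f i * g i) ≡ ∏< k f * ∏< k g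
∏<-* zero    f g = refl
∏<-* (suc k) f g = trans (cong (_* (f k * g k)) (∏<-* k f g)) (ring (∏< k f) (∏< k g) (f k) (g k))
  where
  ring : ∀ a b x y → a * b * (x * y) ≡ a * x * (b * y)
  ring = solve-∀

∏<-^ : ∀ p k f → ∏< k (λ i → p ^ f i) ≡ p ^ Σ< k f
∏<-^ p zero    f = refl
∏<-^ p (suc k) f = trans (cong (_* p ^ f k) (∏<-^ p k f)) (sym (^-distribˡ-+-* p (Σ< k f) (f k)))

∣∏< : ∀ {k i} f → i < k → f i ∣ ∏< k f
∣∏< {suc k} {i} f i<k+1 with i ≟ k
... | yes refl = n∣m*n (∏< k f)
... | no  i≢k  = ∣m⇒∣m*n (f k) (∣∏< f (≤∧≢⇒< (≤-pred i<k+1) i≢k))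

∤-∏< : ∀ {p} k f → Prime p → (∀ {i} → i < k → p ∤ f i) → p ∤ ∏< k f
∤-∏< zero    f p-prime p∤f p∣1 = ¬prime[1] (subst Prime (∣1⇒≡1 p∣1) p-prime)
∤-∏< (suc k) f p-prime p∤f = ∤-* p-prime (∤-∏< k f p-prime (p∤f ∘ m<n⇒m<1+n)) (p∤f ≤-refl)

∏<-∣ : ∀ {j} k f → (∀ {i l} → i < l → l < k → Coprime (f i) (f l)) → (∀ {i} → i < k → f i ∣ j) → ∏< k f ∣ j
∏<-∣ zero    f _        _   = 1∣ _
∏<-∣ (suc k) f pairwise f∣j = coprime⇒*∣ (coprime-∏< k ≤-refl)
  (∏<-∣ k f (λ i<l l<k → pairwise i<l (m<n⇒m<1+n l<k)) (f∣j ∘ m<n⇒m<1+n)) (f∣j ≤-refl)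
  where
  coprime-∏< : ∀ m → m ≤ k → Coprime (∏< m f) (f k)
  coprime-∏< zero    _   = Coprime.1-coprimeTo (f k)
  coprime-∏< (suc m) m<k = coprime-*ˡ (coprime-∏< m (<⇒≤ m<k)) (pairwise m<k ≤-refl)

∏<-cong : ∀ k {f g} → (∀ i → f i ≡ g i) → ∏< k f ≡ ∏< k g
∏<-cong zero    f≡g = refl
∏<-cong (suc k) f≡g = cong₂ _*_ (∏<-cong k f≡g) (f≡g k)

∏<-Val₂₃ : ∀ k {x a c : ℕ → ℕ} (v : ∀ i → Val₂₃ (x i) (a i) (c i)) →
  ∏< k x ≡ 2 ^ Σ< k a * 3 ^ Σ< k c * ∏< k (λ i → Val₂₃.cofactor (v i))
∏<-Val₂₃ k {x} {a} {c} v = begin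
  ∏< k x                                           ≡⟨ ∏<-cong k (λ i → Val₂₃.x≡ (v i)) ⟩
  ∏< k (λ i → 2 ^ a i * 3 ^ c i * w i)             ≡⟨ ∏<-* k (λ i → 2 ^ a i * 3 ^ c i) w ⟩
  ∏< k (λ i → 2 ^ a i * 3 ^ c i) * ∏< k w          ≡⟨ cong (_* ∏< k w) (∏<-* k (λ i → 2 ^ a i) (λ i → 3 ^ c i)) ⟩
  ∏< k (λ i → 2 ^ a i) * ∏< k (λ i → 3 ^ c i) * ∏< k w
    ≡⟨ cong₂ (λ x y → x * y * ∏< k w) (∏<-^ 2 k a) (∏<-^ 3 k c) ⟩
  2 ^ Σ< k a * 3 ^ Σ< k c * ∏< k w                 ∎
  where
  open ≡-Reasoning
  w = λ i → Val₂₃.cofactor (v i)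

∏<5≡ : ∀ f → ∏< 5 f ≡ f 0 * f 1 * f 2 * f 3 * f 4
∏<5≡ f = cong (λ x → x * f 1 * f 2 * f 3 * f 4) (*-identityˡ (f 0))

bigB≡∏< : ∀ n → bigB n ≡ ∏< 5 (λ i → F (n + i))
bigB≡∏< n = sym (trans (∏<5≡ (λ i → F (n + i)))
  (cong (λ x → F x * F (n + 1) * F (n + 2) * F (n + 3) * F (n + 4)) (+-identityʳ n)))

bigN≡∏< : ∀ n → bigN n ≡ ∏< 5 (λ i → n + i)
bigN≡∏< n = sym (trans (∏<5≡ (λ i → n + i))
  (cong (λ x → x * (n + 1) * (n + 2) * (n + 3) * (n + 4)) (+-identityʳ n)))

2^*3^*-∣ : ∀ {a c w j} → 2 ∤ w → 3 ∤ w → 2 ^ a ∣ j → 3 ^ c ∣ j → w ∣ j → 2 ^ a * 3 ^ c * w ∣ j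
2^*3^*-∣ {a} {c} 2∤w 3∤w 2ᵃ∣j 3ᶜ∣j w∣j = coprime⇒*∣ 2ᵃ3ᶜ⊥w (coprime⇒*∣ (coprime[2^a,3^c] a c) 2ᵃ∣j 3ᶜ∣j) w∣j
  where
  2ᵃ3ᶜ⊥w = coprime-*ˡ (coprime-^ˡ (prime∤⇒coprime prime[2] 2∤w) a) (coprime-^ˡ (prime∤⇒coprime prime[3] 3∤w) c)

Val₂₃⇒>0 : ∀ {x a c} → Val₂₃ x a c → 0 < x
Val₂₃⇒>0 {zero} v = contradiction (Val₂₃⇒2∥ v) ¬∥0
Val₂₃⇒>0 {suc x} v = z<s

Attained : {A : Set} → ℕ → (ℕ → A) → A → A → Set
Attained k f z X = (∃[ i ] i < k × X ≡ f i) ⊎ X ≡ z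

record IsMax (k : ℕ) (f : ℕ → ℕ) (z X : ℕ) : Set where
  field
    f≤X      : ∀ {i} → i < k → f i ≤ X
    z≤X      : z ≤ X
    attained : Attained k f z X

prime-to-6∧∣12⇒≡1 : ∀ {w d} → 2 ∤ w → 3 ∤ w → d ∣ w → d ∣ 12 → d ≡ 1
prime-to-6∧∣12⇒≡1 2∤w 3∤w d∣w d∣12 = coprime-*ʳ w⊥2 (coprime-*ʳ w⊥2 w⊥3) (d∣w , d∣12)
  where
  w⊥2 = Coprime.sym (prime∤⇒coprime prime[2] 2∤w)
  w⊥3 = Coprime.sym (prime∤⇒coprime prime[3] 3∤w)

∣n+i∧∣n+l⇒∣l∸i : ∀ {d} n {i l} → i < l → d ∣ n + i → d ∣ n + l → d ∣ l ∸ i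
∣n+i∧∣n+l⇒∣l∸i {d} n {i} {l} i<l d∣n+i d∣n+l = ∣m+n∣m⇒∣n (subst (d ∣_) n+l≡ d∣n+l) d∣n+i
  where
  n+l≡ : n + l ≡ n + i + (l ∸ i)
  n+l≡ = trans (cong (n +_) (sym (m+[n∸m]≡n (<⇒≤ i<l)))) (sym (+-assoc n i (l ∸ i)))

gap∣12 : ∀ {i l} → i < l → l < 5 → l ∸ i ∣ 12 × F (l ∸ i) ∣ 12
gap∣12 {i} {l} i<l l<5 = small (m<n⇒0<n∸m i<l) (≤-trans (s≤s (m∸n≤m l i)) l<5)
  where
  small : ∀ {δ} → 0 < δ → δ < 5 → δ ∣ 12 × F δ ∣ 12
  small {1} _ _ = divides 12 refl , divides 12 refl
  small {2} _ _ = divides 6 refl , divides 12 refl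
  small {3} _ _ = divides 4 refl , divides 6 refl
  small {4} _ _ = divides 3 refl , divides 4 refl
  small {suc (suc (suc (suc (suc _))))} _ (s≤s (s≤s (s≤s (s≤s (s≤s ())))))

odd∣≤2⇒≡1 : ∀ {w x} → 0 < x → x ≤ 2 → w ∣ x → 2 ∤ w → w ≡ 1
odd∣≤2⇒≡1 {0}                 _   _   _   2∤w = contradiction (2 ∣0) 2∤w
odd∣≤2⇒≡1 {1}                 _   _   _   _   = refl
odd∣≤2⇒≡1 {2}                 _   _   _   2∤w = contradiction ∣-refl 2∤w
odd∣≤2⇒≡1 {suc (suc (suc _))} 0<x x≤2 w∣x _   with ≤-trans (∣⇒≤ {{>-nonZero 0<x}} w∣x) x≤2
... | s≤s (s≤s ())

module Window (n : ℕ) {α β : ℕ → ℕ} (v : ∀ i → Val₂₃ (n + i) (α i) (β i)) where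

  a c : ℕ → ℕ
  a i = ν₂F (α i) (β i)
  c i = ν₃F (α i) (β i)

  vF : ∀ i → Val₂₃ (F (n + i)) (a i) (c i)
  vF i = Val₂₃-F (v i)

  open Val₂₃

  u w : ℕ → ℕ
  u i = cofactor (v i)
  w i = cofactor (vF i)

  bigN≡ : bigN n ≡ 2 ^ Σ< 5 α * 3 ^ Σ< 5 β * ∏< 5 u
  bigN≡ = trans (bigN≡∏< n) (∏<-Val₂₃ 5 v)

  bigB≡ : bigB n ≡ 2 ^ Σ< 5 a * 3 ^ Σ< 5 c * ∏< 5 w
  bigB≡ = trans (bigB≡∏< n) (∏<-Val₂₃ 5 vF)

  0<n+i : ∀ i → 0 < n + i
  0<n+i i = Val₂₃⇒>0 (v i)

  u∣n+i : ∀ i → u i ∣ n + i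
  u∣n+i i = subst (u i ∣_) (sym (x≡ (v i))) (n∣m*n (2 ^ α i * 3 ^ β i))

  w∣F[n+i] : ∀ i → w i ∣ F (n + i)
  w∣F[n+i] i = subst (w i ∣_) (sym (x≡ (vF i))) (n∣m*n (2 ^ a i * 3 ^ c i))

  F[n+i]∣bigB : ∀ {i} → i < 5 → F (n + i) ∣ bigB n
  F[n+i]∣bigB {i} i<5 = subst (F (n + i) ∣_) (sym (bigB≡∏< n)) (∣∏< (λ i → F (n + i)) i<5)

  u-coprime : ∀ {i l} → i < l → l < 5 → Coprime (u i) (u l)
  u-coprime {i} {l} i<l l<5 (d∣uᵢ , d∣uₗ) = prime-to-6∧∣12⇒≡1 (2∤cofactor (v i)) (3∤cofactor (v i)) d∣uᵢ
    (∣-trans (∣n+i∧∣n+l⇒∣l∸i n i<l (∣-trans d∣uᵢ (u∣n+i i)) (∣-trans d∣uₗ (u∣n+i l))) (proj₁ (gap∣12 i<l l<5)))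

  w-coprime : ∀ {i l} → i < l → l < 5 → Coprime (w i) (w l)
  w-coprime {i} {l} i<l l<5 (d∣wᵢ , d∣wₗ) = prime-to-6∧∣12⇒≡1 (2∤cofactor (vF i)) (3∤cofactor (vF i)) d∣wᵢ
    (∣-trans d∣F[gcd] (∣-trans (∣⇒F∣F gcd∣gap) (proj₂ (gap∣12 i<l l<5))))
    where
    d∣F[gcd] = ∣F[m]∣F[n]⇒∣F[gcd] (n + i) (n + l) (∣-trans d∣wᵢ (w∣F[n+i] i)) (∣-trans d∣wₗ (w∣F[n+i] l))
    gcd∣gap = ∣n+i∧∣n+l⇒∣l∸i n i<l (gcd[m,n]∣m (n + i) (n + l)) (gcd[m,n]∣n (n + i) (n + l))

  2∤∏u : 2 ∤ ∏< 5 u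
  2∤∏u = ∤-∏< 5 u prime[2] λ {i} _ → 2∤cofactor (v i)

  3∤∏u : 3 ∤ ∏< 5 u
  3∤∏u = ∤-∏< 5 u prime[3] λ {i} _ → 3∤cofactor (v i)

  module EntryPoint {X Y} (X-max : IsMax 5 α (ν₂z (Σ< 5 a)) X) (2≤X : 2 ≤ X)
                          (Y-max : IsMax 5 β (Σ< 5 c ∸ 1) Y) (1≤Y : 1 ≤ Y) where

    K : ℕ
    K = 2 ^ X * 3 ^ Y * ∏< 5 u

    2^∣K : ∀ {e} → e ≤ X → 2 ^ e ∣ K
    2^∣K e≤X = ∣m⇒∣m*n (∏< 5 u) (∣m⇒∣m*n (3 ^ Y) (^-monoʳ-∣ 2 e≤X))

    3^∣K : ∀ {e} → e ≤ Y → 3 ^ e ∣ K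
    3^∣K e≤Y = ∣m⇒∣m*n (∏< 5 u) (∣n⇒∣m*n (2 ^ X) (^-monoʳ-∣ 3 e≤Y))

    n+i∣K : ∀ {i} → i < 5 → n + i ∣ K
    n+i∣K {i} i<5 = subst (_∣ K) (sym (x≡ (v i)))
      (*-pres-∣ (*-pres-∣ (^-monoʳ-∣ 2 (IsMax.f≤X X-max i<5)) (^-monoʳ-∣ 3 (IsMax.f≤X Y-max i<5))) (∣∏< u i<5))

    bigB∣F[K] : bigB n ∣ F K
    bigB∣F[K] = subst (_∣ F K) (sym bigB≡) (2^*3^*-∣ {Σ< 5 a} {Σ< 5 c}
      (∤-∏< 5 w prime[2] λ {i} _ → 2∤cofactor (vF i))
      (∤-∏< 5 w prime[3] λ {i} _ → 3∤cofactor (vF i))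
      (2^ν₂z∣⇒2^∣F (Σ< 5 a) (3^∣K {1} 1≤Y) (2^∣K (IsMax.z≤X X-max)))
      (3^∸1∣⇒3^∣F (Σ< 5 c) (2^∣K {2} 2≤X) (3^∣K (IsMax.z≤X Y-max)))
      (∏<-∣ 5 w w-coprime λ {i} i<5 → ∣-trans (w∣F[n+i] i) (∣⇒F∣F (n+i∣K i<5))))

    module _ {j} (0<j : 0 < j) (bigB∣Fj : bigB n ∣ F j) where

      n+i∣j : ∀ {i} → i < 5 → 3 ≤ n + i → n + i ∣ j
      n+i∣j i<5 3≤n+i = F∣F⇒∣ 3≤n+i 0<j (∣-trans (F[n+i]∣bigB i<5) bigB∣Fj)

      2^X∣j : 2 ^ X ∣ j
      2^X∣j with IsMax.attained X-max
      ... | inj₁ (i , i<5 , refl) = ∣-trans (∥⇒∣ {e = X} (Val₂₃⇒2∥ (v i)) ≤-refl) (n+i∣j i<5 3≤n+i)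
        where
        3≤n+i = ≤-trans (s≤s (s≤s (s≤s z≤n))) (∣⇒≤ {{>-nonZero (0<n+i i)}} (∥⇒∣ {e = 2} (Val₂₃⇒2∥ (v i)) 2≤X))
      ... | inj₂ refl = 2^∣F⇒2^ν₂z∣ (Σ< 5 a) 0<j
        (∣-trans (subst (2 ^ Σ< 5 a ∣_) (sym bigB≡) (∣m⇒∣m*n (∏< 5 w) (∣m⇒∣m*n (3 ^ Σ< 5 c) ∣-refl))) bigB∣Fj)

      3^Y∣j : 3 ^ Y ∣ j
      3^Y∣j with IsMax.attained Y-max
      ... | inj₁ (i , i<5 , refl) = ∣-trans (∥⇒∣ {e = Y} (Val₂₃⇒3∥ (v i)) ≤-refl) (n+i∣j i<5 3≤n+i)
        where
        3≤n+i = ∣⇒≤ {{>-nonZero (0<n+i i)}} (∥⇒∣ {e = 1} (Val₂₃⇒3∥ (v i)) 1≤Y)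
      ... | inj₂ refl = 3^∣F⇒3^∸1∣ (Σ< 5 c) 0<j
        (∣-trans (subst (3 ^ Σ< 5 c ∣_) (sym bigB≡) (∣m⇒∣m*n (∏< 5 w) (∣n⇒∣m*n (2 ^ Σ< 5 a) ∣-refl))) bigB∣Fj)

      u∣j : ∀ {i} → i < 5 → u i ∣ j
      u∣j {i} i<5 with 3 ≤? n + i
      ... | yes 3≤n+i = ∣-trans (u∣n+i i) (n+i∣j i<5 3≤n+i)
      ... | no  3≰n+i = subst (_∣ j) (sym uᵢ≡1) (1∣ j)
        where
        uᵢ≡1 = odd∣≤2⇒≡1 (0<n+i i) (≤-pred (≰⇒> 3≰n+i)) (u∣n+i i) (2∤cofactor (v i))

      K∣j : K ∣ j
      K∣j = 2^*3^*-∣ {X} {Y} 2∤∏u 3∤∏u 2^X∣j 3^Y∣j (∏<-∣ 5 u u-coprime u∣j)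

    IsZ-bigB : IsZ (bigB n) K
    IsZ-bigB = 0<K , bigB∣F[K] , λ j 0<j j<K bigB∣Fj → <⇒≱ j<K (∣⇒≤ {{>-nonZero 0<j}} (K∣j 0<j bigB∣Fj))
      where
      0<K : 0 < K
      0<K = >-nonZero⁻¹ K {{m*n≢0 _ _ {{m*n≢0 _ _ {{m^n≢0 2 X}} {{m^n≢0 3 Y}}}} {{≢-nonZero ∏u≢0}}}}
        where
        ∏u≢0 : ∏< 5 u ≢ 0
        ∏u≢0 ∏u≡0 = 2∤∏u (subst (2 ∣_) (sym ∏u≡0) (2 ∣0))

-- Exponents as affine functions of an unknown excess

Affine : Set
Affine = ℕ × ℕ

offset slope : Affine → ℕ
offset = proj₁
slope  = proj₂

⟦_⟧ : Affine → ℕ → ℕ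
⟦ c , k ⟧ e = c + k * e

_≟ᴬ_ : (A B : Affine) → Dec (A ≡ B)
_≟ᴬ_ = ≡-dec _≟_ _≟_

data Tame : Affine → Set where
  const : ∀ c → Tame (c , 0)
  big   : ∀ c → Tame (2 + c , 1)

_⊕_ : Affine → Affine → Affine
(c , k) ⊕ (c′ , k′) = c + c′ , k + k′

⊕-sound : ∀ A B e → ⟦ A ⊕ B ⟧ e ≡ ⟦ A ⟧ e + ⟦ B ⟧ e
⊕-sound (c , k) (c′ , k′) e = ring c k c′ k′ e
  where
  ring : ∀ c k c′ k′ e → c + c′ + (k + k′) * e ≡ c + k * e + (c′ + k′ * e)
  ring = solve-∀

Σ̂< : ℕ → (ℕ → Affine) → Affine
Σ̂< zero    f = 0 , 0
Σ̂< (suc k) f = Σ̂< k f ⊕ f k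

Σ̂<-sound : ∀ k {g : ℕ → ℕ} (f : ℕ → Affine) e → (∀ {i} → i < k → g i ≡ ⟦ f i ⟧ e) → Σ< k g ≡ ⟦ Σ̂< k f ⟧ e
Σ̂<-sound zero    f e g≡ = refl
Σ̂<-sound (suc k) f e g≡ =
  trans (cong₂ _+_ (Σ̂<-sound k f e (g≡ ∘ m<n⇒m<1+n)) (g≡ ≤-refl)) (sym (⊕-sound (Σ̂< k f) (f k) e))

_≼_ : Affine → Affine → Set
(c , k) ≼ (c′ , k′) = c ≤ c′ × k ≤ k′

≼-sound : ∀ {A B} e → A ≼ B → ⟦ A ⟧ e ≤ ⟦ B ⟧ e
≼-sound e (c≤c′ , k≤k′) = +-mono-≤ c≤c′ (*-monoˡ-≤ e k≤k′)

≼-trans : ∀ {A B C} → A ≼ B → B ≼ C → A ≼ C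
≼-trans (c≤ , k≤) (c≤′ , k≤′) = ≤-trans c≤ c≤′ , ≤-trans k≤ k≤′

_⊔̂_ : Affine → Affine → Affine
(c , k) ⊔̂ (c′ , k′) = c ⊔ c′ , k ⊔ k′

⊔̂< : ℕ → (ℕ → Affine) → Affine → Affine
⊔̂< zero    f z = z
⊔̂< (suc k) f z = ⊔̂< k f z ⊔̂ f k

z≼⊔̂< : ∀ k f z → z ≼ ⊔̂< k f z
z≼⊔̂< zero    f z = ≤-refl , ≤-refl
z≼⊔̂< (suc k) f z = ≼-trans (z≼⊔̂< k f z) (m≤m⊔n _ _ , m≤m⊔n _ _)

f≼⊔̂< : ∀ k f z {i} → i < k → f i ≼ ⊔̂< k f z
f≼⊔̂< (suc k) f z {i} i<k+1 with i ≟ k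
... | yes refl = m≤n⊔m _ _ , m≤n⊔m _ _
... | no  i≢k  = ≼-trans (f≼⊔̂< k f z (≤∧≢⇒< (≤-pred i<k+1) i≢k)) (m≤m⊔n _ _ , m≤m⊔n _ _)

attained? : ∀ k f z X → Dec (Attained k f z X)
attained? k f z X = anyUpTo? (λ i → X ≟ᴬ f i) k ⊎-dec (X ≟ᴬ z)

IsMax-⟦⟧ : ∀ k {g : ℕ → ℕ} {y} f z e → (∀ {i} → i < k → g i ≡ ⟦ f i ⟧ e) → y ≡ ⟦ z ⟧ e →
  Attained k f z (⊔̂< k f z) → IsMax k g y (⟦ ⊔̂< k f z ⟧ e)
IsMax-⟦⟧ k {g} f z e g≡ refl attained = record
  { f≤X      = λ i<k → subst (_≤ _) (sym (g≡ i<k)) (≼-sound e (f≼⊔̂< k f z i<k))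
  ; z≤X      = ≼-sound e (z≼⊔̂< k f z)
  ; attained = map-attained attained
  }
  where
  map-attained : Attained k f z (⊔̂< k f z) → Attained k g (⟦ z ⟧ e) (⟦ ⊔̂< k f z ⟧ e)
  map-attained (inj₁ (i , i<k , X≡fi)) = inj₁ (i , i<k , trans (cong (λ A → ⟦ A ⟧ e) X≡fi) (sym (g≡ i<k)))
  map-attained (inj₂ X≡z)              = inj₂ (cong (λ A → ⟦ A ⟧ e) X≡z)

ν₂F̂ : Affine → Affine → Affine
ν₂F̂ _           (zero , zero) = 0 , 0
ν₂F̂ (zero , k)  _             = 1 , 0
ν₂F̂ (suc c , k) _             = 3 + c , k

ν₂F-⟦⟧ : ∀ {A B} → Tame A → Tame B → ∀ e e′ → ν₂F (⟦ A ⟧ e) (⟦ B ⟧ e′) ≡ ⟦ ν₂F̂ A B ⟧ e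
ν₂F-⟦⟧ (const zero)    (const zero)    e e′ = refl
ν₂F-⟦⟧ (const (suc c)) (const zero)    e e′ = refl
ν₂F-⟦⟧ (big c)         (const zero)    e e′ = refl
ν₂F-⟦⟧ (const zero)    (const (suc c′)) e e′ = refl
ν₂F-⟦⟧ (const (suc c)) (const (suc c′)) e e′ = refl
ν₂F-⟦⟧ (big c)         (const (suc c′)) e e′ = refl
ν₂F-⟦⟧ (const zero)    (big c′)        e e′ = refl
ν₂F-⟦⟧ (const (suc c)) (big c′)        e e′ = refl
ν₂F-⟦⟧ (big c)         (big c′)        e e′ = refl

ν₃F̂ : Affine → Affine → Affine
ν₃F̂ (suc (suc c) , k) (c′ , k′) = suc c′ , k′
ν₃F̂ _                 _         = 0 , 0

ν₃F-⟦⟧ : ∀ {A} B → Tame A → ∀ e e′ → ν₃F (⟦ A ⟧ e) (⟦ B ⟧ e′) ≡ ⟦ ν₃F̂ A B ⟧ e′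
ν₃F-⟦⟧ B (const zero)          e e′ = refl
ν₃F-⟦⟧ B (const (suc zero))    e e′ = refl
ν₃F-⟦⟧ B (const (suc (suc c))) e e′ = refl
ν₃F-⟦⟧ B (big c)               e e′ = refl

ν₂ẑ : Affine → Affine
ν₂ẑ (c , zero)                = ν₂z c , 0
ν₂ẑ (suc (suc (suc c)) , k)   = suc c , k
ν₂ẑ _                         = 0 , 0

ν₂z-⟦⟧ : ∀ A e → slope A ≡ 0 ⊎ 3 ≤ offset A → ν₂z (⟦ A ⟧ e) ≡ ⟦ ν₂ẑ A ⟧ e
ν₂z-⟦⟧ (c , zero) e _ = trans (cong ν₂z (+-identityʳ c)) (sym (+-identityʳ (ν₂z c)))
ν₂z-⟦⟧ (suc (suc (suc c)) , suc k) e _ = refl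
ν₂z-⟦⟧ (zero , suc k)               e (inj₂ ())
ν₂z-⟦⟧ (suc zero , suc k)           e (inj₂ (s≤s ()))
ν₂z-⟦⟧ (suc (suc zero) , suc k)     e (inj₂ (s≤s (s≤s ())))

pred̂ : Affine → Affine
pred̂ (c , k) = c ∸ 1 , k

∸1-⟦⟧ : ∀ A e → slope A ≡ 0 ⊎ 1 ≤ offset A → ⟦ A ⟧ e ∸ 1 ≡ ⟦ pred̂ A ⟧ e
∸1-⟦⟧ (c , zero) e _ = trans (cong (_∸ 1) (+-identityʳ c)) (sym (+-identityʳ (c ∸ 1)))
∸1-⟦⟧ (suc c , suc k) e _ = refl
∸1-⟦⟧ (zero , suc k)  e (inj₂ ())

⟦⟧-split : ∀ {A B} e → slope A ≡ slope B → offset A ≤ offset B → ⟦ B ⟧ e ≡ (offset B ∸ offset A) + ⟦ A ⟧ e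
⟦⟧-split {c , k} {c′ , .k} e refl c≤c′ =
  trans (cong (_+ k * e) (sym (m∸n+n≡m c≤c′))) (+-assoc (c′ ∸ c) c (k * e))

ν₂<8 ν₃<9 : ℕ → ℕ
ν₂<8 2 = 1
ν₂<8 4 = 2
ν₂<8 6 = 1
ν₂<8 _ = 0
ν₃<9 3 = 1
ν₃<9 6 = 1
ν₃<9 _ = 0

-- ν₂ of a number ≡ ρ (mod 8), with e standing for ν₂ ∸ 3 when ρ = 0; likewise ν₃ mod 9.
α̂₈ β̂₉ : ℕ → Affine
α̂₈ zero    = 3 , 1
α̂₈ (suc ρ) = ν₂<8 (suc ρ) , 0
β̂₉ zero    = 2 , 1
β̂₉ (suc ρ) = ν₃<9 (suc ρ) , 0

α̂₈-tame : ∀ ρ → Tame (α̂₈ ρ)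
α̂₈-tame zero    = big 1
α̂₈-tame (suc ρ) = const _

β̂₉-tame : ∀ ρ → Tame (β̂₉ ρ)
β̂₉-tame zero    = big 0
β̂₉-tame (suc ρ) = const _

*-%-cong : ∀ m n d .{{_ : NonZero d}} → (m * n) % d ≡ (m * (n % d)) % d
*-%-cong m n d = trans (cong (λ x → (m * x) % d) (m≡m%n+[m/n]*n n d))
  (trans (cong (_% d) (ring m (n % d) (n / d) d)) ([m+kn]%n≡m%n (m * (n % d)) (m * (n / d)) d))
  where
  ring : ∀ m r q d → m * (r + q * d) ≡ m * r + m * q * d
  ring = solve-∀

%∣⇒∣ : ∀ {p x d} .{{_ : NonZero d}} → p ∣ d → p ∣ x % d → p ∣ x
%∣⇒∣ {p} {x} {d} p∣d p∣x%d = subst (p ∣_) (sym (m≡m%n+[m/n]*n x d)) (∣m∣n⇒∣m+n p∣x%d (∣n⇒∣m*n (x / d) p∣d))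

small-α̂₈? : Dec (∀ {α} → α < 3 → ∀ {q} → q < 8 → 2 ∤ q → α̂₈ ((2 ^ α * q) % 8) ≡ (α , 0))
small-α̂₈? = allUpTo? (λ α → allUpTo? (λ q → ¬? (2 ∣? q) →-dec (α̂₈ ((2 ^ α * q) % 8) ≟ᴬ (α , 0))) 8) 3

small-β̂₉? : Dec (∀ {β} → β < 2 → ∀ {q} → q < 9 → 3 ∤ q → β̂₉ ((3 ^ β * q) % 9) ≡ (β , 0))
small-β̂₉? = allUpTo? (λ β → allUpTo? (λ q → ¬? (3 ∣? q) →-dec (β̂₉ ((3 ^ β * q) % 9) ≟ᴬ (β , 0))) 9) 2

α̂₈-low : ∀ {α o} e → α < 3 → 2 ∤ o → α ≡ ⟦ α̂₈ ((2 ^ α * o) % 8) ⟧ e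
α̂₈-low {α} {o} e α<3 2∤o = sym (begin
  ⟦ α̂₈ ((2 ^ α * o) % 8) ⟧ e          ≡⟨ cong (λ ρ → ⟦ α̂₈ ρ ⟧ e) (*-%-cong (2 ^ α) o 8) ⟩
  ⟦ α̂₈ ((2 ^ α * (o % 8)) % 8) ⟧ e    ≡⟨ cong (λ A → ⟦ A ⟧ e) (from-yes small-α̂₈? α<3 (m%n<n o 8) 2∤o%8) ⟩
  α + 0 * e                          ≡⟨ +-identityʳ α ⟩
  α                                  ∎)
  where
  open ≡-Reasoning
  2∤o%8 : 2 ∤ o % 8
  2∤o%8 2∣o%8 = 2∤o (%∣⇒∣ (divides 4 refl) 2∣o%8)

2^∥⇒≡α̂₈ : ∀ {α x} → 2 ^ α ∥ x → α ≡ ⟦ α̂₈ (x % 8) ⟧ (α ∸ 3)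
2^∥⇒≡α̂₈ {0}               (exact o refl 2∤o) = α̂₈-low 0 (s≤s z≤n) 2∤o
2^∥⇒≡α̂₈ {1}               (exact o refl 2∤o) = α̂₈-low 0 (s≤s (s≤s z≤n)) 2∤o
2^∥⇒≡α̂₈ {2}               (exact o refl 2∤o) = α̂₈-low 0 (s≤s (s≤s (s≤s z≤n))) 2∤o
2^∥⇒≡α̂₈ {suc (suc (suc e))} (exact o refl _) =
  trans (cong (3 +_) (sym (*-identityˡ e))) (cong (λ ρ → ⟦ α̂₈ ρ ⟧ e) (sym x%8≡0))
  where
  ring : ∀ y o → 2 * (2 * (2 * y)) * o ≡ y * o * 8
  ring = solve-∀
  x%8≡0 : (2 ^ (3 + e) * o) % 8 ≡ 0
  x%8≡0 = trans (cong (_% 8) (ring (2 ^ e) o)) (m*n%n≡0 (2 ^ e * o) 8)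

β̂₉-low : ∀ {β o} e → β < 2 → 3 ∤ o → β ≡ ⟦ β̂₉ ((3 ^ β * o) % 9) ⟧ e
β̂₉-low {β} {o} e β<2 3∤o = sym (begin
  ⟦ β̂₉ ((3 ^ β * o) % 9) ⟧ e          ≡⟨ cong (λ ρ → ⟦ β̂₉ ρ ⟧ e) (*-%-cong (3 ^ β) o 9) ⟩
  ⟦ β̂₉ ((3 ^ β * (o % 9)) % 9) ⟧ e    ≡⟨ cong (λ A → ⟦ A ⟧ e) (from-yes small-β̂₉? β<2 (m%n<n o 9) 3∤o%9) ⟩
  β + 0 * e                          ≡⟨ +-identityʳ β ⟩
  β                                  ∎)
  where
  open ≡-Reasoning
  3∤o%9 : 3 ∤ o % 9
  3∤o%9 3∣o%9 = 3∤o (%∣⇒∣ (divides 3 refl) 3∣o%9)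

3^∥⇒≡β̂₉ : ∀ {β x} → 3 ^ β ∥ x → β ≡ ⟦ β̂₉ (x % 9) ⟧ (β ∸ 2)
3^∥⇒≡β̂₉ {0}             (exact o refl 3∤o) = β̂₉-low 0 (s≤s z≤n) 3∤o
3^∥⇒≡β̂₉ {1}             (exact o refl 3∤o) = β̂₉-low 0 (s≤s (s≤s z≤n)) 3∤o
3^∥⇒≡β̂₉ {suc (suc e)}   (exact o refl _) =
  trans (cong (2 +_) (sym (*-identityˡ e))) (cong (λ ρ → ⟦ β̂₉ ρ ⟧ e) (sym x%9≡0))
  where
  ring : ∀ y o → 3 * (3 * y) * o ≡ y * o * 9
  ring = solve-∀
  x%9≡0 : (3 ^ (2 + e) * o) % 9 ≡ 0
  x%9≡0 = trans (cong (_% 9) (ring (3 ^ e) o)) (m*n%n≡0 (3 ^ e * o) 9)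

α̂₈-irrelevant : ∀ ρ {e e′} → (ρ ≡ 0 → e ≡ e′) → ⟦ α̂₈ ρ ⟧ e ≡ ⟦ α̂₈ ρ ⟧ e′
α̂₈-irrelevant zero    e≡e′ = cong (λ e → 3 + 1 * e) (e≡e′ refl)
α̂₈-irrelevant (suc ρ) _    = refl

β̂₉-irrelevant : ∀ ρ {e e′} → (ρ ≡ 0 → e ≡ e′) → ⟦ β̂₉ ρ ⟧ e ≡ ⟦ β̂₉ ρ ⟧ e′
β̂₉-irrelevant zero    e≡e′ = cong (λ e → 2 + 1 * e) (e≡e′ refl)
β̂₉-irrelevant (suc ρ) _    = refl

[n+i]%d≡[n%72+i]%d : ∀ n i d .{{_ : NonZero d}} → d ∣ 72 → (n + i) % d ≡ (n % 72 + i) % d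
[n+i]%d≡[n%72+i]%d n i d d∣72 = begin
  (n + i) % d                    ≡⟨ %-distribˡ-+ n i d ⟩
  (n % d + i % d) % d            ≡⟨ cong (λ x → (x + i % d) % d) (m∣n⇒o%n%m≡o%m d 72 n d∣72) ⟨
  (n % 72 % d + i % d) % d       ≡⟨ %-distribˡ-+ (n % 72) i d ⟨
  (n % 72 + i) % d               ∎
  where open ≡-Reasoning

-- Residues modulo 72

α̂ β̂ â ĉ : ℕ → ℕ → Affine
α̂ r i = α̂₈ ((r + i) % 8)
β̂ r i = β̂₉ ((r + i) % 9)
â r i = ν₂F̂ (α̂ r i) (β̂ r i)
ĉ r i = ν₃F̂ (α̂ r i) (β̂ r i)

Σâ Σĉ X̂ Ŷ : ℕ → Affine
Σâ r = Σ̂< 5 (â r)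
Σĉ r = Σ̂< 5 (ĉ r)
X̂ r  = ⊔̂< 5 (α̂ r) (ν₂ẑ (Σâ r))
Ŷ r  = ⊔̂< 5 (β̂ r) (pred̂ (Σĉ r))

i₈ i₉ : ℕ → ℕ
i₈ r = (8 ∸ r % 8) % 8
i₉ r = (9 ∸ r % 9) % 9

Unique₈ Unique₉ : ℕ → Set
Unique₈ r = ∀ {i} → i < 5 → (r + i) % 8 ≡ 0 → i ≡ i₈ r
Unique₉ r = ∀ {i} → i < 5 → (r + i) % 9 ≡ 0 → i ≡ i₉ r

Consistent : ℕ → Set
Consistent r =
    Unique₈ r × Unique₉ r
  × (slope (Σâ r) ≡ 0 ⊎ 3 ≤ offset (Σâ r))
  × (slope (Σĉ r) ≡ 0 ⊎ 1 ≤ offset (Σĉ r))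
  × Attained 5 (α̂ r) (ν₂ẑ (Σâ r)) (X̂ r)
  × Attained 5 (β̂ r) (pred̂ (Σĉ r)) (Ŷ r)
  × 2 ≤ offset (X̂ r)
  × 1 ≤ offset (Ŷ r)
  × slope (X̂ r) ≡ slope (Σ̂< 5 (α̂ r)) × offset (X̂ r) ≤ offset (Σ̂< 5 (α̂ r))
  × slope (Ŷ r) ≡ slope (Σ̂< 5 (β̂ r)) × offset (Ŷ r) ≤ offset (Σ̂< 5 (β̂ r))

consistent? : ∀ r → Dec (Consistent r)
consistent? r =
      allUpTo? (λ i → ((r + i) % 8 ≟ 0) →-dec (i ≟ i₈ r)) 5
  ×-dec allUpTo? (λ i → ((r + i) % 9 ≟ 0) →-dec (i ≟ i₉ r)) 5
  ×-dec (slope (Σâ r) ≟ 0 ⊎-dec 3 ≤? offset (Σâ r))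
  ×-dec (slope (Σĉ r) ≟ 0 ⊎-dec 1 ≤? offset (Σĉ r))
  ×-dec attained? 5 (α̂ r) (ν₂ẑ (Σâ r)) (X̂ r)
  ×-dec attained? 5 (β̂ r) (pred̂ (Σĉ r)) (Ŷ r)
  ×-dec 2 ≤? offset (X̂ r)
  ×-dec 1 ≤? offset (Ŷ r)
  ×-dec slope (X̂ r) ≟ slope (Σ̂< 5 (α̂ r)) ×-dec offset (X̂ r) ≤? offset (Σ̂< 5 (α̂ r))
  ×-dec slope (Ŷ r) ≟ slope (Σ̂< 5 (β̂ r)) ×-dec offset (Ŷ r) ≤? offset (Σ̂< 5 (β̂ r))

all-consistent : ∀ {r} → r < 72 → Consistent r
all-consistent = from-yes (allUpTo? consistent? 72)

D : ℕ → ℕ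
D r = 2 ^ (offset (Σ̂< 5 (α̂ r)) ∸ offset (X̂ r)) * 3 ^ (offset (Σ̂< 5 (β̂ r)) ∸ offset (Ŷ r))

module Profile (n : ℕ) (0<n : 0 < n) where

  val : ∀ i → ∃₂ (Val₂₃ (n + i))
  val i = ∃-Val₂₃ (≤-trans 0<n (m≤m+n n i))

  α β : ℕ → ℕ
  α i = proj₁ (val i)
  β i = proj₁ (proj₂ (val i))

  v : ∀ i → Val₂₃ (n + i) (α i) (β i)
  v i = proj₂ (proj₂ (val i))

  open Window n v public

  -- e₂ (resp. e₃) is junk when no n + i with i < 5 is divisible by 8 (resp. 9); then no slope-1 form occurs.
  r e₂ e₃ : ℕ
  r  = n % 72
  e₂ = α (i₈ r) ∸ 3
  e₃ = β (i₉ r) ∸ 2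

  module _ (unique₈ : Unique₈ r) (unique₉ : Unique₉ r) where

    α≡ : ∀ {i} → i < 5 → α i ≡ ⟦ α̂ r i ⟧ e₂
    α≡ {i} i<5 = begin
      α i
        ≡⟨ 2^∥⇒≡α̂₈ (Val₂₃⇒2∥ (v i)) ⟩
      ⟦ α̂₈ ((n + i) % 8) ⟧ (α i ∸ 3)
        ≡⟨ cong (λ ρ → ⟦ α̂₈ ρ ⟧ (α i ∸ 3)) ([n+i]%d≡[n%72+i]%d n i 8 (divides 9 refl)) ⟩
      ⟦ α̂₈ ((r + i) % 8) ⟧ (α i ∸ 3)
        ≡⟨ α̂₈-irrelevant ((r + i) % 8) (λ ρ≡0 → cong (λ k → α k ∸ 3) (unique₈ i<5 ρ≡0)) ⟩
      ⟦ α̂ r i ⟧ e₂ ∎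
      where open ≡-Reasoning

    β≡ : ∀ {i} → i < 5 → β i ≡ ⟦ β̂ r i ⟧ e₃
    β≡ {i} i<5 = begin
      β i
        ≡⟨ 3^∥⇒≡β̂₉ (Val₂₃⇒3∥ (v i)) ⟩
      ⟦ β̂₉ ((n + i) % 9) ⟧ (β i ∸ 2)
        ≡⟨ cong (λ ρ → ⟦ β̂₉ ρ ⟧ (β i ∸ 2)) ([n+i]%d≡[n%72+i]%d n i 9 (divides 8 refl)) ⟩
      ⟦ β̂₉ ((r + i) % 9) ⟧ (β i ∸ 2)
        ≡⟨ β̂₉-irrelevant ((r + i) % 9) (λ ρ≡0 → cong (λ k → β k ∸ 2) (unique₉ i<5 ρ≡0)) ⟩
      ⟦ β̂ r i ⟧ e₃ ∎
      where open ≡-Reasoning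

    a≡ : ∀ {i} → i < 5 → a i ≡ ⟦ â r i ⟧ e₂
    a≡ {i} i<5 = trans (cong₂ ν₂F (α≡ i<5) (β≡ i<5))
      (ν₂F-⟦⟧ (α̂₈-tame ((r + i) % 8)) (β̂₉-tame ((r + i) % 9)) e₂ e₃)

    c≡ : ∀ {i} → i < 5 → c i ≡ ⟦ ĉ r i ⟧ e₃
    c≡ {i} i<5 = trans (cong₂ ν₃F (α≡ i<5) (β≡ i<5)) (ν₃F-⟦⟧ (β̂ r i) (α̂₈-tame ((r + i) % 8)) e₂ e₃)

    X-max : (slope (Σâ r) ≡ 0 ⊎ 3 ≤ offset (Σâ r)) → Attained 5 (α̂ r) (ν₂ẑ (Σâ r)) (X̂ r) →
            IsMax 5 α (ν₂z (Σ< 5 a)) (⟦ X̂ r ⟧ e₂)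
    X-max Σâ-ok = IsMax-⟦⟧ 5 (α̂ r) (ν₂ẑ (Σâ r)) e₂ α≡
      (trans (cong ν₂z (Σ̂<-sound 5 (â r) e₂ a≡)) (ν₂z-⟦⟧ (Σâ r) e₂ Σâ-ok))

    Y-max : (slope (Σĉ r) ≡ 0 ⊎ 1 ≤ offset (Σĉ r)) → Attained 5 (β̂ r) (pred̂ (Σĉ r)) (Ŷ r) →
            IsMax 5 β (Σ< 5 c ∸ 1) (⟦ Ŷ r ⟧ e₃)
    Y-max Σĉ-ok = IsMax-⟦⟧ 5 (β̂ r) (pred̂ (Σĉ r)) e₃ β≡
      (trans (cong (_∸ 1) (Σ̂<-sound 5 (ĉ r) e₃ c≡)) (∸1-⟦⟧ (Σĉ r) e₃ Σĉ-ok))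

bigN≡D*z[bigB] : ∀ n → 0 < n → ∃[ K ] IsZ (bigB n) K × bigN n ≡ D (n % 72) * K
bigN≡D*z[bigB] n 0<n = from-profile (all-consistent (m%n<n n 72))
  where
  open Profile n 0<n
  from-profile : Consistent r → ∃[ K ] IsZ (bigB n) K × bigN n ≡ D r * K
  from-profile (unique₈ , unique₉ , Σâ-ok , Σĉ-ok , X̂-attained , Ŷ-attained , 2≤X̂ , 1≤Ŷ ,
                X̂-slope , X̂≤Σα̂ , Ŷ-slope , Ŷ≤Σβ̂) =
    K , IsZ-bigB , bigN≡D*K
    where
    open EntryPoint (X-max unique₈ unique₉ Σâ-ok X̂-attained) (≤-trans 2≤X̂ (m≤m+n _ _))
                    (Y-max unique₈ unique₉ Σĉ-ok Ŷ-attained) (≤-trans 1≤Ŷ (m≤m+n _ _))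

    X = ⟦ X̂ r ⟧ e₂
    Y = ⟦ Ŷ r ⟧ e₃
    s = offset (Σ̂< 5 (α̂ r)) ∸ offset (X̂ r)
    t = offset (Σ̂< 5 (β̂ r)) ∸ offset (Ŷ r)

    Σα≡ : Σ< 5 α ≡ s + X
    Σα≡ = trans (Σ̂<-sound 5 (α̂ r) e₂ (α≡ unique₈ unique₉)) (⟦⟧-split e₂ X̂-slope X̂≤Σα̂)

    Σβ≡ : Σ< 5 β ≡ t + Y
    Σβ≡ = trans (Σ̂<-sound 5 (β̂ r) e₃ (β≡ unique₈ unique₉)) (⟦⟧-split e₃ Ŷ-slope Ŷ≤Σβ̂)

    ring : ∀ a b c d p → a * b * (c * d) * p ≡ a * c * (b * d * p)
    ring = solve-∀

    bigN≡D*K : bigN n ≡ D r * K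
    bigN≡D*K = begin
      bigN n
        ≡⟨ bigN≡ ⟩
      2 ^ Σ< 5 α * 3 ^ Σ< 5 β * ∏< 5 u
        ≡⟨ cong₂ (λ x y → 2 ^ x * 3 ^ y * ∏< 5 u) Σα≡ Σβ≡ ⟩
      2 ^ (s + X) * 3 ^ (t + Y) * ∏< 5 u
        ≡⟨ cong₂ (λ x y → x * y * ∏< 5 u) (^-distribˡ-+-* 2 s X) (^-distribˡ-+-* 3 t Y) ⟩
      2 ^ s * 2 ^ X * (3 ^ t * 3 ^ Y) * ∏< 5 u
        ≡⟨ ring (2 ^ s) (2 ^ X) (3 ^ t) (3 ^ Y) (∏< 5 u) ⟩
      D r * K ∎
      where open ≡-Reasoning

D-on-class? : (H : ℕ → ℕ → Set) → (∀ a b → Dec (H a b)) → ∀ d →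
  Dec (∀ {r} → r < 72 → H (r % 12) r → D r ≡ d)
D-on-class? H H? d = allUpTo? (λ r → H? (r % 12) r →-dec D r ≟ d) 72

IsZ-bigN/d : (H : ℕ → ℕ → Set) (H? : ∀ a b → Dec (H a b)) (d : ℕ) .{{_ : NonZero d}} →
  {True (D-on-class? H H? d)} →
  ∀ n → 0 < n → H (n % 12) (n % 72) → IsZ (bigB n) (bigN n / d)
IsZ-bigN/d H H? d {D≡d} n 0<n h = conclude (bigN≡D*z[bigB] n 0<n)
  where
  D[n%72]≡d : D (n % 72) ≡ d
  D[n%72]≡d = toWitness D≡d (m%n<n n 72)
    (subst (λ a → H a (n % 72)) (sym (m∣n⇒o%n%m≡o%m 12 72 n (divides 6 refl))) h)
  conclude : ∃[ K ] IsZ (bigB n) K × bigN n ≡ D (n % 72) * K → IsZ (bigB n) (bigN n / d)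
  conclude (K , z[bigB]≡K , bigN≡DK) = subst (IsZ (bigB n)) (sym bigN/d≡K) z[bigB]≡K
    where
    bigN/d≡K : bigN n / d ≡ K
    bigN/d≡K = trans (cong (_/ d) (trans bigN≡DK (trans (cong (_* K) D[n%72]≡d) (*-comm d K)))) (m*n/n≡m K d)

corollary3p4 : (n : ℕ) → n ≥ 1 →
      ((n % 12 ≡ 1 ⊎ n % 12 ≡ 7) → IsZ (bigB n) (bigN n / 2))
    × ((n % 12 ≡ 9 ⊎ n % 12 ≡ 11) → IsZ (bigB n) (bigN n / 3))
    × ((n % 12 ≡ 10 ⊎ (n % 72 ≡ 0 ⊎ n % 72 ≡ 20 ⊎ n % 72 ≡ 48 ⊎ n % 72 ≡ 68))
         → IsZ (bigB n) (bigN n / 4))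
    × ((n % 12 ≡ 3 ⊎ n % 12 ≡ 5) → IsZ (bigB n) (bigN n / 6))
    × ((n % 12 ≡ 4 ⊎ (n % 72 ≡ 12 ⊎ n % 72 ≡ 32 ⊎ n % 72 ≡ 36 ⊎ n % 72 ≡ 56))
         → IsZ (bigB n) (bigN n / 8))
    × ((n % 12 ≡ 2 ⊎ n % 12 ≡ 6 ⊎ (n % 72 ≡ 24 ⊎ n % 72 ≡ 44))
         → IsZ (bigB n) (bigN n / 12))
    × ((n % 72 ≡ 8 ⊎ n % 72 ≡ 60) → IsZ (bigB n) (bigN n / 24))
corollary3p4 n n≥1 =
    IsZ-bigN/d (λ a _ → a ≡ 1 ⊎ a ≡ 7) (λ a _ → a ≟ 1 ⊎-dec a ≟ 7) 2 n n≥1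
  , IsZ-bigN/d (λ a _ → a ≡ 9 ⊎ a ≡ 11) (λ a _ → a ≟ 9 ⊎-dec a ≟ 11) 3 n n≥1
  , IsZ-bigN/d (λ a b → a ≡ 10 ⊎ (b ≡ 0 ⊎ b ≡ 20 ⊎ b ≡ 48 ⊎ b ≡ 68))
                 (λ a b → a ≟ 10 ⊎-dec (b ≟ 0 ⊎-dec b ≟ 20 ⊎-dec b ≟ 48 ⊎-dec b ≟ 68)) 4 n n≥1
  , IsZ-bigN/d (λ a _ → a ≡ 3 ⊎ a ≡ 5) (λ a _ → a ≟ 3 ⊎-dec a ≟ 5) 6 n n≥1
  , IsZ-bigN/d (λ a b → a ≡ 4 ⊎ (b ≡ 12 ⊎ b ≡ 32 ⊎ b ≡ 36 ⊎ b ≡ 56))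
                 (λ a b → a ≟ 4 ⊎-dec (b ≟ 12 ⊎-dec b ≟ 32 ⊎-dec b ≟ 36 ⊎-dec b ≟ 56)) 8 n n≥1
  , IsZ-bigN/d (λ a b → a ≡ 2 ⊎ a ≡ 6 ⊎ (b ≡ 24 ⊎ b ≡ 44))
                 (λ a b → a ≟ 2 ⊎-dec a ≟ 6 ⊎-dec (b ≟ 24 ⊎-dec b ≟ 44)) 12 n n≥1
  , IsZ-bigN/d (λ _ b → b ≡ 8 ⊎ b ≡ 60) (λ _ b → b ≟ 8 ⊎-dec b ≟ 60) 24 n n≥1
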